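{- A pandigital seed exists. Specifically, let $k = 4942768284976776320$. Then $\gcd(k, 3\cdot 7) = 1$, and for every digit $d \in \{1,3,7,9\}$ and every integer $n \ge 1$, the number $$s_n = k\cdot 10^n + \frac{d\,(10^n-1)}{9}$$ (obtained by appending $n$ copies of the digit $d$ to the right of the decimal representation of $k$) is composite.
   Context: Given a base-ten digit $d$, a seed for $d$ is a positive integer $k$ coprime to $d$ such that appending any number $n\ge 1$ of copies of $d$ to the right of the decimal representation of $k$, i.e. forming $k\cdot 10^n + d(10^n-1)/9$, always yields a composite number. A pandigital seed is a positive integer $k$ that is a seed for each of the digits $1$, $3$, $7$ and $9$ (so in particular $k$ is coprime to $3$ and $7$). -}

module Defs where

open import Data.Nat using (ℕ; _+_; _*_; _∸_; _^_)
open import Data.Nat.DivMod using (_/_)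

k₀ : ℕ
k₀ = 4942768284976776320

append : ℕ → ℕ → ℕ → ℕ
append k d n = k * 10 ^ n + (d * (10 ^ n ∸ 1)) / 9

-- Appending o copies of d to x gives x · 10^o + dd…d (o digits). Hence if p divides k followed
-- by a+1 copies of d and also the o-digit repdigit dd…d, then p divides k followed by a+1+qo
-- copies for every q. Finitely many such triples (p, o, a), each o dividing L and together
-- hitting every residue mod L, give every appended number a proper factor p < k.
module Submission where

open import Defs
open import Data.Nat using (ℕ; _≟_; zero; suc; _+_; _*_; _∸_; _^_; _≤_; _<_; _≥_; NonZero; NonTrivial)
open import Data.Nat.Properties
  using (+-assoc; +-comm; *-comm; +-identityʳ; *-identityʳ; *-distribˡ-∸; m+n∸m≡n; m≤n*m; m≤m+n; ≤-refl; ≤-trans; <-≤-trans; _<?_; nonTrivial?)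
open import Data.Nat.DivMod using (_/_; _%_; m*n/n≡m; m≡m%n+[m/n]*n; m%n<n; m∣n⇒o%n%m≡o%m)
open import Data.Nat.Divisibility using (_∣_; hasNonTrivialDivisor; _∣?_; ∣m∣n⇒∣m+n; ∣m⇒∣m*n)
open import Data.Nat.GCD using (gcd)
open import Data.Nat.Primality using (Composite)
open import Data.Nat.Tactic.RingSolver using (solve-∀)
open import Data.Fin using (Fin; toℕ; fromℕ<)
open import Data.Fin.Properties using (toℕ-fromℕ<; all?)
open import Data.List using (List; []; _∷_)
open import Data.List.Relation.Unary.Any as Any using (Any; any?)
import Data.List.Relation.Unary.All as List
open import Data.List.Relation.Unary.All using (lookupAny)
open import Data.Sum using (_⊎_; inj₁; inj₂)
open import Data.Product using (_×_; _,_; proj₁; proj₂)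
open import Relation.Nullary.Decidable using (Dec; True; toWitness; _×-dec_)
open import Relation.Binary.PropositionalEquality using (_≡_; refl; sym; trans; cong; subst; module ≡-Reasoning)

append′ : ℕ → ℕ → ℕ → ℕ
append′ k d zero    = k
append′ k d (suc n) = 10 * append′ k d n + d

append′-+ : ∀ k d m n → append′ k d (m + n) ≡ append′ (append′ k d n) d m
append′-+ k d zero    n = refl
append′-+ k d (suc m) n = cong (λ x → 10 * x + d) (append′-+ k d m n)

append′-split : ∀ k d n → append′ k d n ≡ k * 10 ^ n + append′ 0 d n
append′-split k d zero    = sym (trans (+-identityʳ (k * 1)) (*-identityʳ k))
append′-split k d (suc n) rewrite append′-split k d n = lemma k (10 ^ n) (append′ 0 d n) d
  where
  lemma : ∀ k t r d → 10 * (k * t + r) + d ≡ k * (10 * t) + (10 * r + d)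
  lemma = solve-∀

d+9*append′0≡d*10^n : ∀ d n → d + 9 * append′ 0 d n ≡ d * 10 ^ n
d+9*append′0≡d*10^n d zero    = trans (+-identityʳ d) (sym (*-identityʳ d))
d+9*append′0≡d*10^n d (suc n) = begin
  d + 9 * (10 * append′ 0 d n + d) ≡⟨ lemma d (append′ 0 d n) ⟩
  10 * (d + 9 * append′ 0 d n)     ≡⟨ cong (10 *_) (d+9*append′0≡d*10^n d n) ⟩
  10 * (d * 10 ^ n)                ≡⟨ lemma′ d (10 ^ n) ⟩
  d * 10 ^ suc n                   ∎
  where
  open ≡-Reasoning
  lemma : ∀ d r → d + 9 * (10 * r + d) ≡ 10 * (d + 9 * r)
  lemma = solve-∀
  lemma′ : ∀ d t → 10 * (d * t) ≡ d * (10 * t)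
  lemma′ = solve-∀

repdigit≡append′ : ∀ d n → d * (10 ^ n ∸ 1) / 9 ≡ append′ 0 d n
repdigit≡append′ d n = begin
  d * (10 ^ n ∸ 1) / 9           ≡⟨ cong (_/ 9) (*-distribˡ-∸ d (10 ^ n) 1) ⟩
  (d * 10 ^ n ∸ d * 1) / 9       ≡⟨ cong (λ x → (x ∸ d * 1) / 9) (sym (d+9*append′0≡d*10^n d n)) ⟩
  (d + 9 * r ∸ d * 1) / 9        ≡⟨ cong (λ x → (d + 9 * r ∸ x) / 9) (*-identityʳ d) ⟩
  (d + 9 * r ∸ d) / 9            ≡⟨ cong (_/ 9) (m+n∸m≡n d (9 * r)) ⟩
  9 * r / 9                      ≡⟨ cong (_/ 9) (*-comm 9 r) ⟩
  r * 9 / 9                      ≡⟨ m*n/n≡m r 9 ⟩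
  r                              ∎
  where
  open ≡-Reasoning
  r : ℕ
  r = append′ 0 d n

append≡append′ : ∀ k d n → append k d n ≡ append′ k d n
append≡append′ k d n = begin
  k * 10 ^ n + d * (10 ^ n ∸ 1) / 9 ≡⟨ cong (k * 10 ^ n +_) (repdigit≡append′ d n) ⟩
  k * 10 ^ n + append′ 0 d n         ≡⟨ sym (append′-split k d n) ⟩
  append′ k d n                      ∎
  where open ≡-Reasoning

k≤append′ : ∀ k d n → k ≤ append′ k d n
k≤append′ k d zero    = ≤-refl
k≤append′ k d (suc n) = ≤-trans (k≤append′ k d n) (≤-trans (m≤n*m _ 10) (m≤m+n _ d))

∣append′-periodic : ∀ {p k d a} o → p ∣ append′ k d a → p ∣ append′ 0 d o →
                    ∀ q → p ∣ append′ k d (q * o + a)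
∣append′-periodic         o p∣first p∣period zero    = p∣first
∣append′-periodic {k = k} {d} {a} o p∣first p∣period (suc q)
  rewrite +-assoc o (q * o) a | append′-+ k d o (q * o + a)
        | append′-split (append′ k d (q * o + a)) d o
  = ∣m∣n⇒∣m+n (∣m⇒∣m*n _ (∣append′-periodic o p∣first p∣period q)) p∣period

-- The class of n = m + 1 with m ≡ offset (mod period); the shift keeps n = 0 out of every class.
record ResidueClass : Set where
  constructor residueClass
  field
    divisor period offset : ℕ
    {{period-nonZero}} : NonZero period

open ResidueClass

InClass : ℕ → ResidueClass → Set
InClass m c = m % period c ≡ offset c

DividesClass : ℕ → ℕ → ResidueClass → Set
DividesClass k d c = NonTrivial p × p < k × p ∣ append′ k d (suc (offset c)) × p ∣ append′ 0 d (period c)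
  where
  p : ℕ
  p = divisor c

dividesClass? : ∀ k d c → Dec (DividesClass k d c)
dividesClass? k d c = nonTrivial? p ×-dec p <? k
                    ×-dec p ∣? append′ k d (suc (offset c)) ×-dec p ∣? append′ 0 d (period c)
  where
  p : ℕ
  p = divisor c

composite-inClass : ∀ {k d} c → DividesClass k d c → ∀ m → InClass m c → Composite (append′ k d (suc m))
composite-inClass {k} {d} c (nonTrivial , p<k , p∣first , p∣period) m m∈c =
  hasNonTrivialDivisor {{nonTrivial}}
    (<-≤-trans p<k (k≤append′ k d (suc m)))
    (subst (λ i → divisor c ∣ append′ k d i) suc-m≡ (∣append′-periodic o p∣first p∣period (m / o)))
  where
  o : ℕ
  o = period c
  suc-m≡ : m / o * o + suc (offset c) ≡ suc m
  suc-m≡ = begin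
    m / o * o + suc (offset c) ≡⟨ +-comm (m / o * o) _ ⟩
    suc (offset c + m / o * o) ≡⟨ cong (λ r → suc (r + m / o * o)) (sym m∈c) ⟩
    suc (m % o + m / o * o)    ≡⟨ cong suc (sym (m≡m%n+[m/n]*n m o)) ⟩
    suc m                      ∎
    where open ≡-Reasoning

Covers : ℕ → List ResidueClass → Set
Covers L cs = ∀ (r : Fin L) → Any (InClass (toℕ r)) cs

covers? : ∀ L cs → Dec (Covers L cs)
covers? L cs = all? (λ r → any? (λ c → toℕ r % period c ≟ offset c) cs)

inClass-mod : ∀ L .{{_ : NonZero L}} c → period c ∣ L → ∀ m → InClass (m % L) c → InClass m c
inClass-mod L c o∣L m = subst (_≡ offset c) (m∣n⇒o%n%m≡o%m (period c) L m o∣L)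

composite-if-covered : ∀ k d L .{{_ : NonZero L}} (cs : List ResidueClass) →
                       {True (List.all? (λ c → period c ∣? L ×-dec dividesClass? k d c) cs)} →
                       {True (covers? L cs)} →
                       ∀ n → n ≥ 1 → Composite (append k d n)
composite-if-covered k d L cs {valid} {cover} (suc m) _ =
  subst Composite (sym (append≡append′ k d (suc m)))
    (composite-inClass c (proj₂ c-valid) m (inClass-mod L c (proj₁ c-valid) m m%L∈c))
  where
  m%L<L : m % L < L
  m%L<L = m%n<n m L
  hit : Any (InClass (toℕ (fromℕ< m%L<L))) cs
  hit = toWitness cover (fromℕ< m%L<L)
  c : ResidueClass
  c = Any.lookup hit
  c-valid : period c ∣ L × DividesClass k d c
  c-valid = proj₁ (lookupAny (toWitness valid) hit)
  m%L∈c : InClass (m % L) c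
  m%L∈c = subst (λ r → InClass r c) (toℕ-fromℕ< m%L<L) (proj₂ (lookupAny (toWitness valid) hit))

pandigital-1 : ∀ n → n ≥ 1 → Composite (append k₀ 1 n)
pandigital-1 = composite-if-covered k₀ 1 6
  (residueClass 11 2 1 ∷ residueClass 3 3 0 ∷ residueClass 37 3 2 ∷ residueClass 13 6 4 ∷ [])

pandigital-3 : ∀ n → n ≥ 1 → Composite (append k₀ 3 n)
pandigital-3 = composite-if-covered k₀ 3 6
  (residueClass 11 2 1 ∷ residueClass 37 3 2 ∷ residueClass 7 6 4 ∷ residueClass 13 6 0 ∷ [])

pandigital-7 : ∀ n → n ≥ 1 → Composite (append k₀ 7 n)
pandigital-7 = composite-if-covered k₀ 7 30
  (residueClass 11 2 1 ∷ residueClass 3 3 0 ∷ residueClass 37 3 2 ∷ residueClass 41 5 0 ∷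
   residueClass 271 5 4 ∷ residueClass 31 15 1 ∷ residueClass 211 30 22 ∷ residueClass 241 30 28 ∷ [])

pandigital-9 : ∀ n → n ≥ 1 → Composite (append k₀ 9 n)
pandigital-9 = composite-if-covered k₀ 9 8
  (residueClass 11 2 1 ∷ residueClass 101 4 2 ∷ residueClass 73 8 0 ∷ residueClass 137 8 4 ∷ [])

mainTheorem2 : gcd k₀ (3 * 7) ≡ 1
    × ((d : ℕ) → (d ≡ 1 ⊎ d ≡ 3 ⊎ d ≡ 7 ⊎ d ≡ 9) → (n : ℕ) → n ≥ 1 → Composite (append k₀ d n))
mainTheorem2 = refl , λ where
  .1 (inj₁ refl)                → pandigital-1
  .3 (inj₂ (inj₁ refl))         → pandigital-3
  .7 (inj₂ (inj₂ (inj₁ refl)))  → pandigital-7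
  .9 (inj₂ (inj₂ (inj₂ refl)))  → pandigital-9
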